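{- Let $J$, $J_1,J_2,J_3$ be as in the setting described in the context, let $t$ be a colouring of $V(J)$ associated with $\{J_1,J_2,J_3\}$, and let $C$ be a $\beta_t$-cycle with at least six vertices. If $cde$ is a $\beta_t$-path with $c\in V(C)$ and $d\notin V(C)$, then $c\in J_2$, $e\in V(C)$, and $cde$ is a path of a facial $\beta_t$-cycle.
   Context: Setting: $J$ is a $3$-connected, $2$-connected, $3$-colourable plane graph all of whose faces are bounded by $3$-cycles or $4$-cycles, and $\{J_1,J_2,J_3\}$ is a partition of $V(J)$ into three independent sets such that ($a_1$) every vertex of $J_1\cup J_2$ has degree at most $4$, and ($a_2$) if $v\in J_1$ and $v_1,v_2,v_3,v_4$ are consecutive neighbours of $v$ (in the cyclic order around $v$ in the embedding) with $v_1,v_2\in J_3$ and $v_3,v_4\in J_2$, then $v_1$ or $v_2$ has degree at most $4$. Define successively: $X_1$ = set of $v\in J_1$ with at most one neighbour in $J_3$; $X_2$ = set of $v\in J_2$ with at most one neighbour in $J_3$ and no neighbour in $X_1$; $X_3$ = set of vertices of degree $4$ having exactly two non-consecutive neighbours in $J_3$. The preliminary colouring $p:V(J)\to\{\alpha,\beta,\gamma\}$ is $p=\alpha$ on $J_3\cup X_1\cup X_2$, $p=\beta$ on $(J_1\cup J_2)\setminus(X_1\cup X_2\cup X_3)$, $p=\gamma$ on $X_3$. For a (not necessarily proper) colouring $t:V(J)\to\{\alpha,\beta,\gamma\}$, an $\alpha_t$-vertex is a vertex with $t(v)=\alpha$, and a $\beta_t$-cycle (resp. $\beta_t$-path) is a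 cycle (path) of $J$ all of whose vertices have colour $\beta$; similarly for other colours. $t$ is associated with $\{J_1,J_2,J_3\}$ if: (1) every $\beta_t$-cycle is a $\beta_p$-cycle; (2) every $\alpha_t$-vertex of $J_1$ of degree $3$ (resp. $4$) has at most one neighbour (resp. two neighbours) in $J_3$; (3) if an $\alpha_t$-vertex of $J_1$ has two neighbours in $J_3$, then none of its $\beta_t$-neighbours belongs to a $\beta_t$-cycle; (4) every $\alpha_t$-vertex of $J_2$ has at most one neighbour in $J_3$; (5) every vertex of $J_3$ is an $\alpha_t$-vertex; (6) a vertex is a $\gamma_t$-vertex iff it has degree $4$ and exactly two non-consecutive neighbours in $J_3$; (7) the set of $\alpha_t$-vertices in $J_1\cup J_2$ is independent in $J$; (8) the set of all $\alpha_t$-vertices induces a forest in $J$. -}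

module Defs where

open import Data.Nat using (ℕ; zero; suc; _+_; _*_; _≤_; _<_)
open import Data.Fin using (Fin)
open import Data.List using (List; []; _∷_; _++_; length; filter; map; allFin; lookup)
open import Data.Nat.ListAction using (sum)
open import Data.List.Membership.Propositional using (_∈_; _∉_)
open import Data.List.Relation.Unary.Unique.Propositional using (Unique)
open import Data.Product using (Σ; Σ-syntax; ∃; ∃-syntax; _×_; _,_)
open import Data.Sum using (_⊎_)
open import Relation.Binary.PropositionalEquality using (_≡_; _≢_; refl)
open import Relation.Nullary using (¬_; Dec; yes; no)

-- Cyclic orders given as lists.
-- Consec xs a b : b is the successor of a in the cyclic list xs.

Consec : {A : Set} → List A → A → A → Set
Consec xs a b =
  (Σ[ ys ∈ List _ ] Σ[ zs ∈ List _ ] xs ≡ ys ++ a ∷ b ∷ zs)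
  ⊎ (Σ[ ys ∈ List _ ] xs ≡ b ∷ ys ++ a ∷ [])

-- Graphs on vertex set Fin n given by a rotation system:
-- rot v lists the neighbours of v in their cyclic order around v.

Rotation : ℕ → Set
Rotation n = Fin n → List (Fin n)

module _ {n : ℕ} (rot : Rotation n) where

  Adj : Fin n → Fin n → Set
  Adj u v = u ∈ rot v

  deg : Fin n → ℕ
  deg v = length (rot v)

  sumDeg : ℕ
  sumDeg = sum (map deg (allFin n))

  -- closed walks of length k, as k-periodic sequences of vertices
  Periodic : ℕ → (ℕ → Fin n) → Set
  Periodic k w = ∀ i → w (i + k) ≡ w i

  OnCycle : ℕ → (ℕ → Fin n) → Fin n → Set
  OnCycle k w x = Σ[ i ∈ ℕ ] (i < k × w i ≡ x)

  IsCycle : ℕ → (ℕ → Fin n) → Set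
  IsCycle k w =
    3 ≤ k × Periodic k w × (∀ i → Adj (w i) (w (suc i)))
    × (∀ i j → i < k → j < k → w i ≡ w j → i ≡ j)

  -- facial walk: an orbit of the face permutation
  --   (u , v) ↦ (v , successor of u in rot v)
  -- on darts, of length k (traversed once).
  FacialWalk : ℕ → (ℕ → Fin n) → Set
  FacialWalk k w =
    1 ≤ k × Periodic k w
    × (∀ i → Consec (rot (w (suc i))) (w i) (w (suc (suc i))))
    × (∀ i j → i < k → j < k → w i ≡ w j → w (suc i) ≡ w (suc j) → i ≡ j)

  DartIn : Fin n → Fin n → Σ ℕ (λ _ → ℕ → Fin n) → Set
  DartIn u v (k , w) = Σ[ i ∈ ℕ ] (i < k × w i ≡ u × w (suc i) ≡ v)

  data Reach (S : List (Fin n)) : Fin n → Fin n → Set where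
    here : ∀ {u} → Reach S u u
    step : ∀ {u w v} → Adj u w → w ∉ S → Reach S w v → Reach S u v

  KConnected : ℕ → Set
  KConnected k = k < n × (∀ (S : List (Fin n)) → length S < k →
    ∀ u v → u ∉ S → v ∉ S → Reach S u v)

-- Plane graphs: a simple graph with a rotation system of genus 0,
-- i.e. whose faces (orbits of the face permutation, listed explicitly
-- in 'faces', each exactly once) satisfy Euler's formula
--   |V| - |E| + |F| = 2   (with 2|E| = sum of degrees).

Face : ℕ → Set
Face n = Σ ℕ (λ _ → ℕ → Fin n)

record PlaneGraph (n : ℕ) : Set where
  field
    rot        : Rotation n
    rot-unique : ∀ v → Unique (rot v)
    irrefl     : ∀ v → v ∉ rot v
    symm       : ∀ u v → u ∈ rot v → v ∈ rot u
    faces      : List (Face n)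
    faces-facial : ∀ (p : Fin (length faces)) →
      let f = lookup faces p in FacialWalk rot (Data.Product.proj₁ f) (Data.Product.proj₂ f)
    dart-cover : ∀ u v → Adj rot u v →
      Σ[ p ∈ Fin (length faces) ] DartIn rot u v (lookup faces p)
    dart-unique : ∀ u v (p q : Fin (length faces)) →
      DartIn rot u v (lookup faces p) → DartIn rot u v (lookup faces q) → p ≡ q
    euler : 2 * (n + length faces) ≡ sumDeg rot + 4

data Part : Set where
  P₁ P₂ P₃ : Part

_≟ₚ_ : (a b : Part) → Dec (a ≡ b)
P₁ ≟ₚ P₁ = yes refl
P₁ ≟ₚ P₂ = no λ ()
P₁ ≟ₚ P₃ = no λ ()
P₂ ≟ₚ P₁ = no λ ()
P₂ ≟ₚ P₂ = yes refl
P₂ ≟ₚ P₃ = no λ ()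
P₃ ≟ₚ P₁ = no λ ()
P₃ ≟ₚ P₂ = no λ ()
P₃ ≟ₚ P₃ = yes refl

data Col : Set where
  α β γ : Col

record Setting (n : ℕ) : Set where
  field
    G : PlaneGraph n
  open PlaneGraph G public
  field
    conn3 : KConnected rot 3
    conn2 : KConnected rot 2
    col3  : Σ[ c ∈ (Fin n → Fin 3) ] (∀ u v → Adj rot u v → c u ≢ c v)
    faces34 : ∀ (p : Fin (length faces)) →
      let f = lookup faces p in
      (Data.Product.proj₁ f ≡ 3 ⊎ Data.Product.proj₁ f ≡ 4)
      × IsCycle rot (Data.Product.proj₁ f) (Data.Product.proj₂ f)
    -- the partition {J₁,J₂,J₃} into independent sets
    part  : Fin n → Part
    indep : ∀ u v → Adj rot u v → part u ≢ part v
    a1 : ∀ v → part v ≢ P₃ → deg rot v ≤ 4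
    a2 : ∀ v v₁ v₂ v₃ v₄ → part v ≡ P₁ →
      Consec (rot v) v₁ v₂ → Consec (rot v) v₂ v₃ → Consec (rot v) v₃ v₄ →
      part v₁ ≡ P₃ → part v₂ ≡ P₃ → part v₃ ≡ P₂ → part v₄ ≡ P₂ →
      deg rot v₁ ≤ 4 ⊎ deg rot v₂ ≤ 4

module _ {n : ℕ} (S : Setting n) where
  open Setting S

  n₃ : Fin n → ℕ
  n₃ v = length (filter (λ u → part u ≟ₚ P₃) (rot v))

  X₁ : Fin n → Set
  X₁ v = part v ≡ P₁ × n₃ v ≤ 1

  X₂ : Fin n → Set
  X₂ v = part v ≡ P₂ × n₃ v ≤ 1 × (∀ u → Adj rot u v → ¬ X₁ u)

  X₃ : Fin n → Set
  X₃ v = deg rot v ≡ 4 × n₃ v ≡ 2 ×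
    (∀ a b → Consec (rot v) a b → ¬ (part a ≡ P₃ × part b ≡ P₃))

  PBeta : Fin n → Set
  PBeta v = part v ≢ P₃ × ¬ X₁ v × ¬ X₂ v × ¬ X₃ v

  module _ (t : Fin n → Col) where

    ColCycle : Col → ℕ → (ℕ → Fin n) → Set
    ColCycle c k w = IsCycle rot k w × (∀ i → t (w i) ≡ c)

    OnBetaCycle : Fin n → Set
    OnBetaCycle x = Σ[ k ∈ ℕ ] Σ[ w ∈ (ℕ → Fin n) ] (ColCycle β k w × OnCycle rot k w x)

    record Associated : Set where
      field
        as1 : ∀ k w → ColCycle β k w → ∀ i → PBeta (w i)
        as2 : ∀ v → part v ≡ P₁ → t v ≡ α →
          (deg rot v ≡ 3 → n₃ v ≤ 1) × (deg rot v ≡ 4 → n₃ v ≤ 2)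
        as3 : ∀ v → part v ≡ P₁ → t v ≡ α → n₃ v ≡ 2 →
          ∀ u → Adj rot u v → t u ≡ β → ¬ OnBetaCycle u
        as4 : ∀ v → part v ≡ P₂ → t v ≡ α → n₃ v ≤ 1
        as5 : ∀ v → part v ≡ P₃ → t v ≡ α
        as6 : ∀ v → (t v ≡ γ → X₃ v) × (X₃ v → t v ≡ γ)
        as7 : ∀ u v → part u ≢ P₃ → part v ≢ P₃ → t u ≡ α → t v ≡ α → ¬ Adj rot u v
        as8 : ∀ k w → ¬ ColCycle α k w

    BetaPath : Fin n → Fin n → Fin n → Set
    BetaPath c d e = Adj rot c d × Adj rot d e × c ≢ d × d ≢ e × c ≢ e
      × t c ≡ β × t d ≡ β × t e ≡ β

    OnFacialBetaCycle : Fin n → Fin n → Fin n → Set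
    OnFacialBetaCycle c d e = Σ[ k ∈ ℕ ] Σ[ w ∈ (ℕ → Fin n) ]
      (FacialWalk rot k w × ColCycle β k w ×
       Σ[ i ∈ ℕ ] ((w i ≡ c × w (suc i) ≡ d × w (suc (suc i)) ≡ e)
                 ⊎ (w i ≡ e × w (suc i) ≡ d × w (suc (suc i)) ≡ c)))

-- Let a, a′ be the neighbours of c on C and b, b′ their other neighbours on C. All of them
-- are β_p-vertices, so c ∉ X₁, which forces c ∈ J₂: in J₁ its three neighbours a, a′, d outside
-- J₃ would leave room for at most one in J₃. Then a ∈ J₁ ∖ (X₁ ∪ X₃) has c, b ∈ J₂ consecutive
-- around it, with a J₃-neighbour on the far side of c; since c and b are not adjacent the face
-- there is a square c a b y with y a neighbour of c, and likewise there is a square c a′ b′ y′.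
-- If y = d, the square is a facial β_t-cycle through d, and d ∉ X₁ leaves b as the only
-- possible e (same for y′). Otherwise y = y′ is the fourth neighbour of c; the squares cannot
-- lie on the same side of c, and on opposite sides they put c between two J₃-vertices around
-- d, so d ∈ X₃ and t(d) = γ, a contradiction.

module Submission where

open import Defs
open import Data.Nat using (ℕ; zero; suc; _+_; _∸_; _≤_; _<_; z≤n; s≤s; _≤?_; _<?_)
import Data.Nat.Properties as ℕ
open import Data.Bool using (Bool; true; false)
import Data.Bool.Properties as Bool
open import Data.Fin using (Fin; zero; suc)
open import Data.Fin.Properties using (_≟_; all?; any?)
open import Data.Maybe using (Maybe; just; nothing; fromMaybe)
import Data.Maybe as Maybe
open import Data.Vec using (Vec; []; _∷_)
import Data.Vec as Vec
open import Data.List using (List; []; _∷_; _++_; length; filter; lookup)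
open import Data.List.Membership.Propositional using (_∈_; _∉_)
open import Data.List.Membership.Propositional.Properties using (∈-lookup)
open import Data.List.Relation.Unary.Any using (here; there; index)
open import Data.List.Relation.Unary.Any.Properties using (lookup-index)
import Data.List.Relation.Unary.All as All
open import Data.List.Relation.Unary.AllPairs using (_∷_)
open import Data.List.Relation.Unary.Unique.Propositional using (Unique)
open import Data.Product using (Σ; Σ-syntax; ∃; _×_; _,_; proj₁; proj₂; map₁)
open import Data.Sum using (_⊎_; inj₁; inj₂)
import Data.Sum as Sum
open import Data.Empty using (⊥; ⊥-elim)
open import Relation.Binary.PropositionalEquality using (_≡_; _≢_; refl; sym; trans; cong; subst; ≢-sym)
open import Relation.Nullary using (¬_; Dec; yes; no; does)
open import Relation.Nullary.Decidable using (True; toWitness; map′; ¬?; _×-dec_; _⊎-dec_; _→-dec_)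
open import Relation.Unary using (Decidable)

-- A rotation with at most four entries is modelled by the positions Fin L with their cyclic
-- successor, its J₃-entries by a marking; each fact is checked by evaluating a decision
-- procedure for L = 0, …, 4.
module CyclicPositions where

  succ? : ∀ {L} → Fin (suc L) → Maybe (Fin (suc L))
  succ? {zero}  zero    = nothing
  succ? {suc L} zero    = just (suc zero)
  succ? {suc L} (suc i) = Maybe.map suc (succ? i)

  next : ∀ {L} → Fin L → Fin L
  next {suc L} i = fromMaybe zero (succ? i)

  distinct⇒2≤ : ∀ {L} (i j : Fin L) → i ≢ j → 2 ≤ L
  distinct⇒2≤ zero zero i≢j = ⊥-elim (i≢j refl)
  distinct⇒2≤ {suc zero} zero (suc ())
  distinct⇒2≤ {suc zero} (suc ()) _
  distinct⇒2≤ {suc (suc L)} _ _ _ = s≤s (s≤s z≤n)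

  Marking : ℕ → Set
  Marking = Vec Bool

  Marked Unmarked : ∀ {L} → Marking L → Fin L → Set
  Marked   m i = Vec.lookup m i ≡ true
  Unmarked m i = Vec.lookup m i ≡ false

  #marked : ∀ {L} → Marking L → ℕ
  #marked []          = 0
  #marked (true ∷ m)  = suc (#marked m)
  #marked (false ∷ m) = #marked m

  OppositeMarks : ∀ {L} → Marking L → Set
  OppositeMarks {L} m = L ≡ 4 × #marked m ≡ 2 × (∀ i → ¬ (Marked m i × Marked m (next i)))

  marked? : ∀ {L} (m : Marking L) i → Dec (Marked m i)
  marked? m i = Vec.lookup m i Bool.≟ true

  unmarked? : ∀ {L} (m : Marking L) i → Dec (Unmarked m i)
  unmarked? m i = Vec.lookup m i Bool.≟ false

  opposite? : ∀ {L} (m : Marking L) → Dec (OppositeMarks m)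
  opposite? {L} m = (L ℕ.≟ 4) ×-dec (#marked m ℕ.≟ 2) ×-dec
    all? λ i → ¬? (marked? m i ×-dec marked? m (next i))

  all-markings? : ∀ {L} {Q : Marking L → Set} → (∀ m → Dec (Q m)) → Dec (∀ m → Q m)
  all-markings? {zero} Q? = map′ (λ q → λ { [] → q }) (λ f → f []) (Q? [])
  all-markings? {suc L} Q? =
    map′ (λ (q₁ , q₀) → λ { (true ∷ m) → q₁ m ; (false ∷ m) → q₀ m })
         (λ f → (λ m → f (true ∷ m)) , (λ m → f (false ∷ m)))
         (all-markings? (λ m → Q? (true ∷ m)) ×-dec all-markings? (λ m → Q? (false ∷ m)))

  decide≤4 : {Q : ℕ → Set} (Q? : ∀ L → Dec (Q L)) →
    {q₀ : True (Q? 0)} {q₁ : True (Q? 1)} {q₂ : True (Q? 2)} {q₃ : True (Q? 3)} {q₄ : True (Q? 4)} →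
    ∀ {L} → L ≤ 4 → Q L
  decide≤4 _ {q₀ = q} {L = 0} _ = toWitness q
  decide≤4 _ {q₁ = q} {L = 1} _ = toWitness q
  decide≤4 _ {q₂ = q} {L = 2} _ = toWitness q
  decide≤4 _ {q₃ = q} {L = 3} _ = toWitness q
  decide≤4 _ {q₄ = q} {L = 4} _ = toWitness q
  decide≤4 _ {L = suc (suc (suc (suc (suc _))))} (s≤s (s≤s (s≤s (s≤s ()))))

  next-injective : ∀ {L} → L ≤ 4 → ∀ (i j : Fin L) → next i ≡ next j → i ≡ j
  next-injective = decide≤4 λ L → all? λ (i : Fin L) → all? λ j → (next i ≟ next j) →-dec (i ≟ j)

  next-irrefl : ∀ {L} → L ≤ 4 → 2 ≤ L → ∀ (i : Fin L) → i ≢ next i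
  next-irrefl = decide≤4 λ L → (2 ≤? L) →-dec all? λ (i : Fin L) → ¬? (i ≟ next i)

  fourth-position-unique : ∀ {L} → L ≤ 4 → ∀ (a b c y y′ : Fin L) →
    a ≢ b → a ≢ c → b ≢ c → y ≢ a → y ≢ b → y ≢ c → y′ ≢ a → y′ ≢ b → y′ ≢ c → y ≡ y′
  fourth-position-unique = decide≤4 λ L →
    all? λ (a : Fin L) → all? λ b → all? λ c → all? λ y → all? λ y′ →
    ¬? (a ≟ b) →-dec ¬? (a ≟ c) →-dec ¬? (b ≟ c) →-dec
    ¬? (y ≟ a) →-dec ¬? (y ≟ b) →-dec ¬? (y ≟ c) →-dec
    ¬? (y′ ≟ a) →-dec ¬? (y′ ≟ b) →-dec ¬? (y′ ≟ c) →-dec (y ≟ y′)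

  four-cycle : ∀ {L} → L ≤ 4 → ∀ (a a′ d x : Fin L) →
    a ≢ a′ → a ≢ d → a ≢ x → a′ ≢ d → a′ ≢ x → d ≢ x →
    next x ≡ a → next a′ ≡ x → next a ≡ d × next d ≡ a′
  four-cycle = decide≤4 λ L →
    all? λ (a : Fin L) → all? λ a′ → all? λ d → all? λ x →
    ¬? (a ≟ a′) →-dec ¬? (a ≟ d) →-dec ¬? (a ≟ x) →-dec
    ¬? (a′ ≟ d) →-dec ¬? (a′ ≟ x) →-dec ¬? (d ≟ x) →-dec
    (next x ≟ a) →-dec (next a′ ≟ x) →-dec (next a ≟ d) ×-dec (next d ≟ a′)

  unmarked-pair-exhaustive : ∀ {L} → L ≤ 4 → ∀ (m : Marking L) (u v z : Fin L) →
    u ≢ v → Unmarked m u → Unmarked m v → 2 ≤ #marked m → Unmarked m z → z ≡ u ⊎ z ≡ v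
  unmarked-pair-exhaustive = decide≤4 λ L →
    all-markings? λ m → all? λ (u : Fin L) → all? λ v → all? λ z →
    ¬? (u ≟ v) →-dec unmarked? m u →-dec unmarked? m v →-dec
    (2 ≤? #marked m) →-dec unmarked? m z →-dec ((z ≟ u) ⊎-dec (z ≟ v))

  unmarked-pair-adjacent : ∀ {L} → L ≤ 4 → ∀ (m : Marking L) (u v : Fin L) →
    u ≢ v → Unmarked m u → Unmarked m v → 2 ≤ #marked m → ¬ OppositeMarks m →
    (next u ≡ v × ∃ λ q → next q ≡ u × Marked m q) ⊎ (next v ≡ u × ∃ λ q → next u ≡ q × Marked m q)
  unmarked-pair-adjacent = decide≤4 λ L →
    all-markings? λ m → all? λ (u : Fin L) → all? λ v →
    ¬? (u ≟ v) →-dec unmarked? m u →-dec unmarked? m v →-dec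
    (2 ≤? #marked m) →-dec ¬? (opposite? m) →-dec
    (((next u ≟ v) ×-dec any? λ q → (next q ≟ u) ×-dec marked? m q)
     ⊎-dec ((next v ≟ u) ×-dec any? λ q → (next u ≟ q) ×-dec marked? m q))

  flanked-unmarked⇒opposite : ∀ {L} → L ≤ 4 → ∀ (m : Marking L) (c q q′ e : Fin L) →
    next c ≡ q → next q′ ≡ c → Marked m q → Marked m q′ →
    Unmarked m c → Unmarked m e → e ≢ c → OppositeMarks m
  flanked-unmarked⇒opposite = decide≤4 λ L →
    all-markings? λ m → all? λ (c : Fin L) → all? λ q → all? λ q′ → all? λ e →
    (next c ≟ q) →-dec (next q′ ≟ c) →-dec
    marked? m q →-dec marked? m q′ →-dec
    unmarked? m c →-dec unmarked? m e →-dec ¬? (e ≟ c) →-dec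
    opposite? m

module SmallCyclicLists {A : Set} where

  open CyclicPositions

  Consec⇒∈ : ∀ {xs : List A} {a b} → Consec xs a b → a ∈ xs × b ∈ xs
  Consec⇒∈ (inj₁ (ys , zs , refl)) = go ys
    where
    go : ∀ ys → _ ∈ (ys ++ _ ∷ _ ∷ zs) × _ ∈ (ys ++ _ ∷ _ ∷ zs)
    go []       = here refl , there (here refl)
    go (y ∷ ys) = there (proj₁ (go ys)) , there (proj₂ (go ys))
  Consec⇒∈ (inj₂ (ys , refl)) = there (go ys) , here refl
    where
    go : ∀ ys → _ ∈ (ys ++ _ ∷ [])
    go []       = here refl
    go (y ∷ ys) = there (go ys)

  ∈⇒position : ∀ {z : A} {xs} → z ∈ xs → Σ (Fin (length xs)) λ i → lookup xs i ≡ z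
  ∈⇒position z∈xs = index z∈xs , sym (lookup-index z∈xs)

  lookup-injective : ∀ {xs : List A} → Unique xs → ∀ {i j} → lookup xs i ≡ lookup xs j → i ≡ j
  lookup-injective (_ ∷ _) {zero} {zero} _ = refl
  lookup-injective (x∉ ∷ _) {zero} {suc j} e = ⊥-elim (All.lookup x∉ (∈-lookup j) e)
  lookup-injective (x∉ ∷ _) {suc i} {zero} e = ⊥-elim (All.lookup x∉ (∈-lookup i) (sym e))
  lookup-injective (_ ∷ u) {suc i} {suc j} e = cong suc (lookup-injective u e)

  lookup-≢ : ∀ (xs : List A) {i j} → lookup xs i ≢ lookup xs j → i ≢ j
  lookup-≢ xs ne i≡j = ne (cong (lookup xs) i≡j)

  Consec⇒next : ∀ (xs : List A) {a b} → length xs ≤ 4 → Consec xs a b →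
    2 ≤ length xs × Σ (Fin (length xs)) λ i → lookup xs i ≡ a × lookup xs (next i) ≡ b
  Consec⇒next (_ ∷ _ ∷ []) _ (inj₁ ([] , _ , refl)) = s≤s (s≤s z≤n) , zero , refl , refl
  Consec⇒next (_ ∷ _ ∷ []) _ (inj₁ (_ ∷ [] , _ , ()))
  Consec⇒next (_ ∷ _ ∷ []) _ (inj₁ (_ ∷ _ ∷ [] , _ , ()))
  Consec⇒next (_ ∷ _ ∷ []) _ (inj₁ (_ ∷ _ ∷ _ ∷ _ , _ , ()))
  Consec⇒next (_ ∷ _ ∷ []) _ (inj₂ ([] , refl)) = s≤s (s≤s z≤n) , suc zero , refl , refl
  Consec⇒next (_ ∷ _ ∷ []) _ (inj₂ (_ ∷ [] , ()))
  Consec⇒next (_ ∷ _ ∷ []) _ (inj₂ (_ ∷ _ ∷ _ , ()))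
  Consec⇒next (_ ∷ _ ∷ _ ∷ []) _ (inj₁ ([] , _ , refl)) = s≤s (s≤s z≤n) , zero , refl , refl
  Consec⇒next (_ ∷ _ ∷ _ ∷ []) _ (inj₁ (_ ∷ [] , _ , refl)) = s≤s (s≤s z≤n) , suc zero , refl , refl
  Consec⇒next (_ ∷ _ ∷ _ ∷ []) _ (inj₁ (_ ∷ _ ∷ [] , _ , ()))
  Consec⇒next (_ ∷ _ ∷ _ ∷ []) _ (inj₁ (_ ∷ _ ∷ _ ∷ [] , _ , ()))
  Consec⇒next (_ ∷ _ ∷ _ ∷ []) _ (inj₁ (_ ∷ _ ∷ _ ∷ _ ∷ _ , _ , ()))
  Consec⇒next (_ ∷ _ ∷ _ ∷ []) _ (inj₂ ([] , ()))
  Consec⇒next (_ ∷ _ ∷ _ ∷ []) _ (inj₂ (_ ∷ [] , refl)) = s≤s (s≤s z≤n) , suc (suc zero) , refl , refl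
  Consec⇒next (_ ∷ _ ∷ _ ∷ []) _ (inj₂ (_ ∷ _ ∷ [] , ()))
  Consec⇒next (_ ∷ _ ∷ _ ∷ []) _ (inj₂ (_ ∷ _ ∷ _ ∷ _ , ()))
  Consec⇒next (_ ∷ _ ∷ _ ∷ _ ∷ []) _ (inj₁ ([] , _ , refl)) = s≤s (s≤s z≤n) , zero , refl , refl
  Consec⇒next (_ ∷ _ ∷ _ ∷ _ ∷ []) _ (inj₁ (_ ∷ [] , _ , refl)) = s≤s (s≤s z≤n) , suc zero , refl , refl
  Consec⇒next (_ ∷ _ ∷ _ ∷ _ ∷ []) _ (inj₁ (_ ∷ _ ∷ [] , _ , refl)) = s≤s (s≤s z≤n) , suc (suc zero) , refl , refl
  Consec⇒next (_ ∷ _ ∷ _ ∷ _ ∷ []) _ (inj₁ (_ ∷ _ ∷ _ ∷ [] , _ , ()))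
  Consec⇒next (_ ∷ _ ∷ _ ∷ _ ∷ []) _ (inj₁ (_ ∷ _ ∷ _ ∷ _ ∷ [] , _ , ()))
  Consec⇒next (_ ∷ _ ∷ _ ∷ _ ∷ []) _ (inj₁ (_ ∷ _ ∷ _ ∷ _ ∷ _ ∷ _ , _ , ()))
  Consec⇒next (_ ∷ _ ∷ _ ∷ _ ∷ []) _ (inj₂ ([] , ()))
  Consec⇒next (_ ∷ _ ∷ _ ∷ _ ∷ []) _ (inj₂ (_ ∷ [] , ()))
  Consec⇒next (_ ∷ _ ∷ _ ∷ _ ∷ []) _ (inj₂ (_ ∷ _ ∷ [] , refl)) = s≤s (s≤s z≤n) , suc (suc (suc zero)) , refl , refl
  Consec⇒next (_ ∷ _ ∷ _ ∷ _ ∷ []) _ (inj₂ (_ ∷ _ ∷ _ ∷ [] , ()))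
  Consec⇒next (_ ∷ _ ∷ _ ∷ _ ∷ []) _ (inj₂ (_ ∷ _ ∷ _ ∷ _ ∷ _ , ()))
  Consec⇒next [] _ (inj₁ ([] , _ , ()))
  Consec⇒next [] _ (inj₁ (_ ∷ _ , _ , ()))
  Consec⇒next [] _ (inj₂ (_ , ()))
  Consec⇒next (_ ∷ []) _ (inj₁ ([] , _ , ()))
  Consec⇒next (_ ∷ []) _ (inj₁ (_ ∷ [] , _ , ()))
  Consec⇒next (_ ∷ []) _ (inj₁ (_ ∷ _ ∷ _ , _ , ()))
  Consec⇒next (_ ∷ []) _ (inj₂ ([] , ()))
  Consec⇒next (_ ∷ []) _ (inj₂ (_ ∷ _ , ()))
  Consec⇒next (_ ∷ _ ∷ _ ∷ _ ∷ _ ∷ _) (s≤s (s≤s (s≤s (s≤s ())))) _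

  next⇒Consec : ∀ (xs : List A) → 2 ≤ length xs → length xs ≤ 4 →
    ∀ i → Consec xs (lookup xs i) (lookup xs (next i))
  next⇒Consec (_ ∷ _ ∷ []) _ _ zero = inj₁ ([] , [] , refl)
  next⇒Consec (_ ∷ _ ∷ []) _ _ (suc zero) = inj₂ ([] , refl)
  next⇒Consec (_ ∷ _ ∷ _ ∷ []) _ _ zero = inj₁ ([] , _ , refl)
  next⇒Consec (_ ∷ _ ∷ _ ∷ []) _ _ (suc zero) = inj₁ (_ ∷ [] , _ , refl)
  next⇒Consec (_ ∷ _ ∷ _ ∷ []) _ _ (suc (suc zero)) = inj₂ (_ ∷ [] , refl)
  next⇒Consec (_ ∷ _ ∷ _ ∷ _ ∷ []) _ _ zero = inj₁ ([] , _ , refl)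
  next⇒Consec (_ ∷ _ ∷ _ ∷ _ ∷ []) _ _ (suc zero) = inj₁ (_ ∷ [] , _ , refl)
  next⇒Consec (_ ∷ _ ∷ _ ∷ _ ∷ []) _ _ (suc (suc zero)) = inj₁ (_ ∷ _ ∷ [] , _ , refl)
  next⇒Consec (_ ∷ _ ∷ _ ∷ _ ∷ []) _ _ (suc (suc (suc zero))) = inj₂ (_ ∷ _ ∷ [] , refl)
  next⇒Consec (_ ∷ _ ∷ _ ∷ _ ∷ _ ∷ _) _ (s≤s (s≤s (s≤s (s≤s ())))) _
  next⇒Consec [] () _ _
  next⇒Consec (_ ∷ []) (s≤s ()) _ _

  next≡⇒Consec : ∀ (xs : List A) → 2 ≤ length xs → length xs ≤ 4 →
    ∀ {i j} → next i ≡ j → Consec xs (lookup xs i) (lookup xs j)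
  next≡⇒Consec xs 2≤ ≤4 {i} refl = next⇒Consec xs 2≤ ≤4 i

  module _ {xs : List A} (unique : Unique xs) (≤4 : length xs ≤ 4) where

    Consec-functional : ∀ {a b b′} → Consec xs a b → Consec xs a b′ → b ≡ b′
    Consec-functional ab ab′ with Consec⇒next xs ≤4 ab | Consec⇒next xs ≤4 ab′
    ... | _ , i , refl , refl | _ , j , i≡j , refl with lookup-injective unique i≡j
    ... | refl = refl

    Consec-injective : ∀ {a a′ b} → Consec xs a b → Consec xs a′ b → a ≡ a′
    Consec-injective ab a′b with Consec⇒next xs ≤4 ab | Consec⇒next xs ≤4 a′b
    ... | _ , i , refl , refl | _ , j , refl , e
      with next-injective ≤4 i j (lookup-injective unique (sym e))
    ... | refl = refl

    Consec-irrefl : ∀ {a b} → Consec xs a b → a ≢ b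
    Consec-irrefl ab a≡b with Consec⇒next xs ≤4 ab
    ... | 2≤ , i , refl , e = next-irrefl ≤4 2≤ i (lookup-injective unique (trans a≡b (sym e)))

    fourth-element-unique : ∀ {a b c y y′} → a ∈ xs → b ∈ xs → c ∈ xs → y ∈ xs → y′ ∈ xs →
      a ≢ b → a ≢ c → b ≢ c → y ≢ a → y ≢ b → y ≢ c → y′ ≢ a → y′ ≢ b → y′ ≢ c → y ≡ y′
    fourth-element-unique a∈ b∈ c∈ y∈ y′∈ a≢b a≢c b≢c y≢a y≢b y≢c y′≢a y′≢b y′≢c
      with ∈⇒position a∈ | ∈⇒position b∈ | ∈⇒position c∈ | ∈⇒position y∈ | ∈⇒position y′∈
    ... | ia , refl | ib , refl | ic , refl | iy , refl | iy′ , refl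
      with fourth-position-unique ≤4 ia ib ic iy iy′ (lookup-≢ xs a≢b) (lookup-≢ xs a≢c) (lookup-≢ xs b≢c)
             (lookup-≢ xs y≢a) (lookup-≢ xs y≢b) (lookup-≢ xs y≢c) (lookup-≢ xs y′≢a) (lookup-≢ xs y′≢b) (lookup-≢ xs y′≢c)
    ... | refl = refl

    Consec-four-cycle : ∀ {a a′ d x} → d ∈ xs →
      a ≢ a′ → a ≢ d → a ≢ x → a′ ≢ d → a′ ≢ x → d ≢ x →
      Consec xs x a → Consec xs a′ x → Consec xs a d × Consec xs d a′
    Consec-four-cycle d∈ a≢a′ a≢d a≢x a′≢d a′≢x d≢x xa a′x
      with Consec⇒next xs ≤4 xa | Consec⇒next xs ≤4 a′x | ∈⇒position d∈
    ... | 2≤ , ix , refl , refl | _ , ia′ , refl , e | id , refl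
      with four-cycle ≤4 (next ix) ia′ id ix (lookup-≢ xs a≢a′) (lookup-≢ xs a≢d) (lookup-≢ xs a≢x)
             (lookup-≢ xs a′≢d) (lookup-≢ xs a′≢x) (lookup-≢ xs d≢x) refl (lookup-injective unique e)
    ... | ad , da′ = next≡⇒Consec xs 2≤ ≤4 ad , next≡⇒Consec xs 2≤ ≤4 da′

  module Counting (P : A → Set) (P? : Decidable P) where

    count : List A → ℕ
    count xs = length (filter P? xs)

    Opposite : List A → Set
    Opposite xs = length xs ≡ 4 × count xs ≡ 2 × (∀ a b → Consec xs a b → ¬ (P a × P b))

    marking : (xs : List A) → Marking (length xs)
    marking []       = []
    marking (x ∷ xs) = does (P? x) ∷ marking xs

    count≡#marked : ∀ xs → count xs ≡ #marked (marking xs)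
    count≡#marked []       = refl
    count≡#marked (x ∷ xs) with does (P? x)
    ... | true  = cong suc (count≡#marked xs)
    ... | false = count≡#marked xs

    marking-lookup : ∀ xs i → Vec.lookup (marking xs) i ≡ does (P? (lookup xs i))
    marking-lookup (x ∷ xs) zero    = refl
    marking-lookup (x ∷ xs) (suc i) = marking-lookup xs i

    P⇒marked : ∀ xs {i} → P (lookup xs i) → Marked (marking xs) i
    P⇒marked xs {i} p with P? (lookup xs i) | marking-lookup xs i
    ... | yes _ | e = e
    ... | no ¬p | _ = ⊥-elim (¬p p)

    ¬P⇒unmarked : ∀ xs {i} → ¬ P (lookup xs i) → Unmarked (marking xs) i
    ¬P⇒unmarked xs {i} ¬p with P? (lookup xs i) | marking-lookup xs i
    ... | yes p | _ = ⊥-elim (¬p p)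
    ... | no _  | e = e

    marked⇒P : ∀ xs {i} → Marked (marking xs) i → P (lookup xs i)
    marked⇒P xs {i} m with P? (lookup xs i) | marking-lookup xs i
    ... | yes p | _ = p
    ... | no _  | e with trans (sym m) e
    ...   | ()

    module _ {xs : List A} (unique : Unique xs) (≤4 : length xs ≤ 4) where

      opposite-marks⇒Opposite : OppositeMarks (marking xs) → Opposite xs
      opposite-marks⇒Opposite (l≡4 , #≡2 , apart) =
        l≡4 , trans (count≡#marked xs) #≡2 , λ a b ab (pa , pb) →
          let (_ , i , ea , eb) = Consec⇒next xs ≤4 ab
          in apart i (P⇒marked xs (subst P (sym ea) pa) , P⇒marked xs (subst P (sym eb) pb))

      ¬P-pair-exhaustive : ∀ {u v z} → u ∈ xs → v ∈ xs → u ≢ v → ¬ P u → ¬ P v →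
        2 ≤ count xs → z ∈ xs → ¬ P z → z ≡ u ⊎ z ≡ v
      ¬P-pair-exhaustive u∈ v∈ u≢v ¬pu ¬pv 2≤ z∈ ¬pz
        with ∈⇒position u∈ | ∈⇒position v∈ | ∈⇒position z∈
      ... | iu , refl | iv , refl | iz , refl
        with unmarked-pair-exhaustive ≤4 (marking xs) iu iv iz (lookup-≢ xs u≢v)
               (¬P⇒unmarked xs ¬pu) (¬P⇒unmarked xs ¬pv) (subst (2 ≤_) (count≡#marked xs) 2≤)
               (¬P⇒unmarked xs ¬pz)
      ... | inj₁ refl = inj₁ refl
      ... | inj₂ refl = inj₂ refl

      three-¬P⇒count≤1 : ∀ {u v w} → u ∈ xs → v ∈ xs → w ∈ xs → u ≢ v → u ≢ w → v ≢ w →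
        ¬ P u → ¬ P v → ¬ P w → count xs ≤ 1
      three-¬P⇒count≤1 u∈ v∈ w∈ u≢v u≢w v≢w ¬pu ¬pv ¬pw with count xs ≤? 1
      ... | yes ≤1 = ≤1
      ... | no ≰1 with ¬P-pair-exhaustive u∈ v∈ u≢v ¬pu ¬pv (ℕ.≰⇒> ≰1) w∈ ¬pw
      ...   | inj₁ w≡u = ⊥-elim (u≢w (sym w≡u))
      ...   | inj₂ w≡v = ⊥-elim (v≢w (sym w≡v))

      ¬P-pair-adjacent : ∀ {u v} → u ∈ xs → v ∈ xs → u ≢ v → ¬ P u → ¬ P v →
        2 ≤ count xs → ¬ Opposite xs →
        (Consec xs u v × ∃ λ q → Consec xs q u × P q) ⊎ (Consec xs v u × ∃ λ q → Consec xs u q × P q)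
      ¬P-pair-adjacent u∈ v∈ u≢v ¬pu ¬pv 2≤ ¬opp
        with ∈⇒position u∈ | ∈⇒position v∈
      ... | iu , refl | iv , refl
        with unmarked-pair-adjacent ≤4 (marking xs) iu iv (lookup-≢ xs u≢v)
               (¬P⇒unmarked xs ¬pu) (¬P⇒unmarked xs ¬pv) (subst (2 ≤_) (count≡#marked xs) 2≤)
               (λ opp → ¬opp (opposite-marks⇒Opposite opp))
      ... | inj₁ (uv , q , qu , mq) =
        inj₁ (consec uv , lookup xs q , consec qu , marked⇒P xs mq)
        where
        consec : ∀ {i j} → next i ≡ j → Consec xs (lookup xs i) (lookup xs j)
        consec = next≡⇒Consec xs (distinct⇒2≤ iu iv (lookup-≢ xs u≢v)) ≤4
      ... | inj₂ (vu , q , uq , mq) =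
        inj₂ (consec vu , lookup xs q , consec uq , marked⇒P xs mq)
        where
        consec : ∀ {i j} → next i ≡ j → Consec xs (lookup xs i) (lookup xs j)
        consec = next≡⇒Consec xs (distinct⇒2≤ iu iv (lookup-≢ xs u≢v)) ≤4

      flanked-¬P⇒Opposite : ∀ {c q q′ e} → Consec xs c q → Consec xs q′ c → P q → P q′ →
        ¬ P c → e ∈ xs → ¬ P e → e ≢ c → Opposite xs
      flanked-¬P⇒Opposite cq q′c pq pq′ ¬pc e∈ ¬pe e≢c
        with Consec⇒next xs ≤4 cq | Consec⇒next xs ≤4 q′c | ∈⇒position e∈
      ... | _ , ic , refl , refl | _ , iq′ , refl , e | ie , refl =
        opposite-marks⇒Opposite (flanked-unmarked⇒opposite ≤4 (marking xs) ic (next ic) iq′ ie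
          refl (lookup-injective unique e) (P⇒marked xs pq) (P⇒marked xs pq′)
          (¬P⇒unmarked xs ¬pc) (¬P⇒unmarked xs ¬pe) (lookup-≢ xs e≢c))

module RotationCycles {n : ℕ} (rot : Rotation n) where

  shift : ℕ → (ℕ → Fin n) → ℕ → Fin n
  shift s w x = w (s + x)

  shift-start : ∀ s (w : ℕ → Fin n) → shift s w 0 ≡ w s
  shift-start s w = cong w (ℕ.+-identityʳ s)

  shift-step : ∀ s (w : ℕ → Fin n) x → shift s w (suc x) ≡ w (suc (s + x))
  shift-step s w x = cong w (ℕ.+-suc s x)

  module _ {k : ℕ} {w : ℕ → Fin n} (periodic : Periodic rot k w) {s : ℕ} (s<k : s < k) where

    reduce : ∀ {x} → x < k → Σ[ r ∈ ℕ ] r < k × w (s + x) ≡ w r × (s + x ≡ r ⊎ s + x ≡ r + k)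
    reduce {x} x<k with s + x <? k
    ... | yes s+x<k = s + x , s+x<k , refl , inj₁ refl
    ... | no s+x≮k = s + x ∸ k , r<k , trans (cong w (sym wrap)) (periodic (s + x ∸ k)) , inj₂ (sym wrap)
      where
      wrap : s + x ∸ k + k ≡ s + x
      wrap = ℕ.m∸n+n≡m (ℕ.≮⇒≥ s+x≮k)
      r<k : s + x ∸ k < k
      r<k = ℕ.+-cancelʳ-< k _ _ (subst (_< k + k) (sym wrap) (ℕ.+-mono-< s<k x<k))

    shift-OnCycle : ∀ {v} → OnCycle rot k (shift s w) v → OnCycle rot k w v
    shift-OnCycle (x , x<k , refl) with reduce x<k
    ... | r , r<k , e , _ = r , r<k , sym e

    shift-injective : (∀ i j → i < k → j < k → w i ≡ w j → i ≡ j) →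
      ∀ x y → x < k → y < k → shift s w x ≡ shift s w y → x ≡ y
    shift-injective injective x y x<k y<k e with reduce x<k | reduce y<k
    ... | r , r<k , ex , hx | r′ , r′<k , ey , hy
      with injective r r′ r<k r′<k (trans (sym ex) (trans e ey))
    ... | refl = residues hx hy
      where
      wrapped-too-far : ∀ {x y r} → y < k → s + x ≡ r → s + y ≡ r + k → ⊥
      wrapped-too-far {x} {y} y<k sx sy = ℕ.<⇒≱ y<k (subst (k ≤_) (sym y≡x+k) (ℕ.m≤n+m k x))
        where
        y≡x+k : y ≡ x + k
        y≡x+k = ℕ.+-cancelˡ-≡ s y (x + k) (trans sy (trans (cong (_+ k) (sym sx)) (ℕ.+-assoc s x k)))
      residues : (s + x ≡ r ⊎ s + x ≡ r + k) → (s + y ≡ r ⊎ s + y ≡ r + k) → x ≡ y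
      residues (inj₁ sx) (inj₁ sy) = ℕ.+-cancelˡ-≡ s x y (trans sx (sym sy))
      residues (inj₂ sx) (inj₂ sy) = ℕ.+-cancelˡ-≡ s x y (trans sx (sym sy))
      residues (inj₁ sx) (inj₂ sy) = ⊥-elim (wrapped-too-far y<k sx sy)
      residues (inj₂ sx) (inj₁ sy) = ⊥-elim (wrapped-too-far x<k sy sx)

  shift-IsCycle : ∀ {k w s} → IsCycle rot k w → s < k → IsCycle rot k (shift s w)
  shift-IsCycle {k} {w} {s} (3≤k , periodic , adjacent , injective) s<k =
    3≤k ,
    (λ x → trans (cong w (sym (ℕ.+-assoc s x k))) (periodic (s + x))) ,
    (λ x → subst (Adj rot (w (s + x))) (sym (shift-step s w x)) (adjacent (s + x))) ,
    shift-injective periodic s<k injective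

  Rotating : (ℕ → Fin n) → Set
  Rotating w = ∀ i → Consec (rot (w (suc i))) (w i) (w (suc (suc i)))

  shift-Rotating : ∀ {w} → Rotating w → ∀ s → Rotating (shift s w)
  shift-Rotating {w} rotating s i
    rewrite ℕ.+-suc s (suc i) | ℕ.+-suc s i = rotating (s + i)

  rotating-at : ∀ {w} → Rotating w → ∀ i {x y z} →
    w i ≡ x → w (suc i) ≡ y → w (suc (suc i)) ≡ z → Consec (rot y) x z
  rotating-at rotating i refl refl refl = rotating i

  FacialCycle : ℕ → (ℕ → Fin n) → Set
  FacialCycle k w = IsCycle rot k w × Rotating w

  FacialCycle⇒FacialWalk : ∀ {k w} → FacialCycle k w → FacialWalk rot k w
  FacialCycle⇒FacialWalk ((3≤k , periodic , _ , injective) , rotating) =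
    ℕ.≤-trans (s≤s z≤n) 3≤k , periodic , rotating , λ i j i<k j<k e _ → injective i j i<k j<k e

module Configuration {n : ℕ} (S : Setting n) (t : Fin n → Col) (As : Associated S t) where

  open Setting S
  open Associated As
  open RotationCycles rot
  open SmallCyclicLists
  open Counting (λ u → part u ≡ P₃) (λ u → part u ≟ₚ P₃)

  J₃ : Fin n → Set
  J₃ v = part v ≡ P₃

  β⇒∉J₃ : ∀ {v} → t v ≡ β → ¬ J₃ v
  β⇒∉J₃ {v} tv v∈J₃ with trans (sym tv) (as5 v v∈J₃)
  ... | ()

  β⇒¬X₃ : ∀ {v} → t v ≡ β → ¬ X₃ S v
  β⇒¬X₃ {v} tv X₃v with trans (sym tv) (proj₂ (as6 v) X₃v)
  ... | ()

  P₂⇒∉J₃ : ∀ {v} → part v ≡ P₂ → ¬ J₃ v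
  P₂⇒∉J₃ p₂ p₃ with trans (sym p₂) p₃
  ... | ()

  J₂-nonadjacent : ∀ {u v} → part u ≡ P₂ → part v ≡ P₂ → u ∉ rot v
  J₂-nonadjacent {u} {v} pu pv u∈v = indep u v u∈v (trans pu (sym pv))

  only-P₁-left : ∀ {p} → p ≢ P₂ → p ≢ P₃ → p ≡ P₁
  only-P₁-left {P₁} _ _ = refl
  only-P₁-left {P₂} ¬2 _ = ⊥-elim (¬2 refl)
  only-P₁-left {P₃} _ ¬3 = ⊥-elim (¬3 refl)

  only-P₂-left : ∀ {p} → p ≢ P₁ → p ≢ P₃ → p ≡ P₂
  only-P₂-left {P₁} ¬1 _ = ⊥-elim (¬1 refl)
  only-P₂-left {P₂} _ _ = refl
  only-P₂-left {P₃} _ ¬3 = ⊥-elim (¬3 refl)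

  J₂-neighbour : ∀ {u v} → u ∈ rot v → part v ≡ P₂ → ¬ J₃ u → part u ≡ P₁
  J₂-neighbour {u} {v} u∈v pv = only-P₁-left λ pu → indep u v u∈v (trans pu (sym pv))

  J₁-neighbour : ∀ {u v} → u ∈ rot v → part v ≡ P₁ → ¬ J₃ u → part u ≡ P₂
  J₁-neighbour {u} {v} u∈v pv = only-P₂-left λ pu → indep u v u∈v (trans pu (sym pv))

  deg≤4 : ∀ {v} → ¬ J₃ v → length (rot v) ≤ 4
  deg≤4 {v} = a1 v

  rot-functional : ∀ {v a b b′} → ¬ J₃ v → Consec (rot v) a b → Consec (rot v) a b′ → b ≡ b′
  rot-functional ¬v = Consec-functional (rot-unique _) (deg≤4 ¬v)

  rot-injective : ∀ {v a a′ b} → ¬ J₃ v → Consec (rot v) a b → Consec (rot v) a′ b → a ≡ a′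
  rot-injective ¬v = Consec-injective (rot-unique _) (deg≤4 ¬v)

  rot-irrefl : ∀ {v a b} → ¬ J₃ v → Consec (rot v) a b → a ≢ b
  rot-irrefl ¬v = Consec-irrefl (rot-unique _) (deg≤4 ¬v)

  two-J₃-neighbours : ∀ {v} → PBeta S v → part v ≡ P₁ → 2 ≤ count (rot v)
  two-J₃-neighbours (_ , ¬X₁ , _) p₁ = ℕ.≰⇒> λ ≤1 → ¬X₁ (p₁ , ≤1)

  three-neighbours⇒J₂ : ∀ {v u₁ u₂ u₃} → PBeta S v → u₁ ∈ rot v → u₂ ∈ rot v → u₃ ∈ rot v →
    u₁ ≢ u₂ → u₁ ≢ u₃ → u₂ ≢ u₃ → ¬ J₃ u₁ → ¬ J₃ u₂ → ¬ J₃ u₃ → part v ≡ P₂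
  three-neighbours⇒J₂ {v} (¬v , ¬X₁ , _) u₁∈ u₂∈ u₃∈ u₁≢u₂ u₁≢u₃ u₂≢u₃ ¬u₁ ¬u₂ ¬u₃ =
    only-P₂-left (λ p₁ → ¬X₁ (p₁ , three-¬P⇒count≤1 (rot-unique v) (deg≤4 ¬v) u₁∈ u₂∈ u₃∈
                                     u₁≢u₂ u₁≢u₃ u₂≢u₃ ¬u₁ ¬u₂ ¬u₃)) ¬v

  face-after : ∀ {x₀ x₁ x₂} → ¬ J₃ x₁ → Consec (rot x₁) x₀ x₂ →
    Σ[ k ∈ ℕ ] (k ≡ 3 ⊎ k ≡ 4) × Σ[ w ∈ (ℕ → Fin n) ] FacialCycle k w × w 0 ≡ x₀ × w 1 ≡ x₁ × w 2 ≡ x₂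
  face-after {x₀} {x₁} ¬x₁ x₀x₂ with dart-cover x₀ x₁ (proj₁ (Consec⇒∈ x₀x₂))
  ... | p , j , j<k , wj , wj+1 =
    proj₁ face , proj₁ (faces34 p) , shift j (proj₂ face) , (cycle , rotating) , w0 , w1 ,
    rot-functional ¬x₁ (rotating-at rotating 0 w0 w1 refl) x₀x₂
    where
    face : Face n
    face = lookup faces p
    cycle : IsCycle rot (proj₁ face) (shift j (proj₂ face))
    cycle = shift-IsCycle (proj₂ (faces34 p)) j<k
    rotating : Rotating (shift j (proj₂ face))
    rotating = shift-Rotating (proj₁ (proj₂ (proj₂ (faces-facial p)))) j
    w0 : shift j (proj₂ face) 0 ≡ x₀
    w0 = trans (shift-start j (proj₂ face)) wj
    w1 : shift j (proj₂ face) 1 ≡ x₁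
    w1 = trans (cong (proj₂ face) (ℕ.+-comm j 1)) wj+1

  triangle-or-square : ∀ {k w} {X : Set} → (k ≡ 3 ⊎ k ≡ 4) → FacialCycle k w →
    (w 3 ≡ w 0 → X) → (FacialCycle 4 w → X) → X
  triangle-or-square (inj₁ refl) ((_ , periodic , _) , _) triangle _ = triangle (periodic 0)
  triangle-or-square (inj₂ refl) face _ square = square face

  Square : Fin n → Fin n → Fin n → Fin n → Set
  Square x₀ x₁ x₂ x₃ =
    Σ[ w ∈ (ℕ → Fin n) ] FacialCycle 4 w × w 0 ≡ x₀ × w 1 ≡ x₁ × w 2 ≡ x₂ × w 3 ≡ x₃

  Square-rotation : ∀ {x₀ x₁ x₂ x₃} → Square x₀ x₁ x₂ x₃ →
    Consec (rot x₁) x₀ x₂ × Consec (rot x₂) x₁ x₃ × Consec (rot x₃) x₂ x₀ × Consec (rot x₀) x₃ x₁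
  Square-rotation {x₀} (w , ((_ , periodic , _) , rotating) , w0 , w1 , w2 , w3) =
    at 0 w0 w1 w2 , at 1 w1 w2 w3 , at 2 w2 w3 w4 , at 3 w3 w4 (trans (periodic 1) w1)
    where
    at : ∀ i {x y z} → w i ≡ x → w (suc i) ≡ y → w (suc (suc i)) ≡ z → Consec (rot y) x z
    at = rotating-at rotating
    w4 : w 4 ≡ x₀
    w4 = trans (periodic 0) w0

  square-after : ∀ {x₀ x₁ x₂} → ¬ J₃ x₁ → Consec (rot x₁) x₀ x₂ → ¬ Consec (rot x₂) x₁ x₀ →
    ∃ (Square x₀ x₁ x₂)
  square-after ¬x₁ x₀x₂ not-triangle with face-after ¬x₁ x₀x₂
  ... | _ , k≡3⊎4 , w , face , w0 , w1 , w2 =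
    triangle-or-square k≡3⊎4 face
      (λ w3≡w0 → ⊥-elim (not-triangle (rotating-at (proj₂ face) 1 w1 w2 (trans w3≡w0 w0))))
      (λ square → w 3 , w , square , w0 , w1 , w2 , refl)

  square-of-path : ∀ {x₀ x₁ x₂ x₃} → ¬ J₃ x₁ → ¬ J₃ x₂ →
    Consec (rot x₁) x₀ x₂ → Consec (rot x₂) x₁ x₃ → x₃ ≢ x₀ → Square x₀ x₁ x₂ x₃
  square-of-path ¬x₁ ¬x₂ x₀x₂ x₁x₃ x₃≢x₀
    with square-after ¬x₁ x₀x₂ (λ x₁x₀ → x₃≢x₀ (rot-functional ¬x₂ x₁x₃ x₁x₀))
  ... | y , sq = subst (Square _ _ _) (rot-functional ¬x₂ (proj₁ (proj₂ (Square-rotation sq))) x₁x₃) sq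

  β-square-cycle : ∀ {x₀ x₁ x₂ x₃} (sq : Square x₀ x₁ x₂ x₃) →
    t x₀ ≡ β → t x₁ ≡ β → t x₂ ≡ β → t x₃ ≡ β → ColCycle S t β 4 (proj₁ sq)
  β-square-cycle (w , (cycle@(_ , periodic , _) , _) , refl , refl , refl , refl) t₀ t₁ t₂ t₃ =
    cycle , coloured
    where
    coloured : ∀ i → t (w i) ≡ β
    coloured 0 = t₀
    coloured 1 = t₁
    coloured 2 = t₂
    coloured 3 = t₃
    coloured (suc (suc (suc (suc i)))) =
      trans (cong t (trans (cong w (ℕ.+-comm 4 i)) (periodic i))) (coloured i)

  β-square⇒PBeta : ∀ {x₀ x₁ x₂ x₃} → Square x₀ x₁ x₂ x₃ →
    t x₀ ≡ β → t x₁ ≡ β → t x₂ ≡ β → t x₃ ≡ β → PBeta S x₃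
  β-square⇒PBeta sq@(w , _ , _ , _ , _ , w3) t₀ t₁ t₂ t₃ =
    subst (PBeta S) w3 (as1 4 w (β-square-cycle sq t₀ t₁ t₂ t₃) 3)

  β-square⇒OnFacialBetaCycle : ∀ {x₀ x₁ x₂ x₃} → Square x₀ x₁ x₂ x₃ →
    t x₀ ≡ β → t x₁ ≡ β → t x₂ ≡ β → t x₃ ≡ β → OnFacialBetaCycle S t x₂ x₃ x₀
  β-square⇒OnFacialBetaCycle sq@(w , face@((_ , periodic , _) , _) , w0 , _ , w2 , w3) t₀ t₁ t₂ t₃ =
    4 , w , FacialCycle⇒FacialWalk face , β-square-cycle sq t₀ t₁ t₂ t₃ ,
    2 , inj₁ (w2 , w3 , trans (periodic 0) w0)

  OnFacialBetaCycle-sym : ∀ {c d e} → OnFacialBetaCycle S t c d e → OnFacialBetaCycle S t e d c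
  OnFacialBetaCycle-sym (k , w , facial , cycle , i , path) = k , w , facial , cycle , i , Sum.swap path

  -- c a b is a path of the cycle C, which avoids d
  record Arm (c d a b : Fin n) : Set where
    field
      a∈c : a ∈ rot c
      b∈a : b ∈ rot a
      a-β : t a ≡ β
      a-p : PBeta S a
      b-β : t b ≡ β
      c≢b : c ≢ b
      a≢d : a ≢ d

  -- the face at a beyond the path c a b is the square with fourth vertex y, and the
  -- J₃-vertex q lies next to c around a, on the side away from b
  data Wing (c a b y : Fin n) : Set where
    wing⁺ : ∀ {q} → Square c a b y → J₃ q → Consec (rot a) q c → Wing c a b y
    wing⁻ : ∀ {q} → Square b a c y → J₃ q → Consec (rot a) c q → Wing c a b y

  wing-apex : ∀ {c a b y} → ¬ J₃ c → Wing c a b y → y ∈ rot c × b ∈ rot y × y ≢ a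
  wing-apex ¬c (wing⁺ sq _ _) =
    let (_ , _ , y-bc , c-ya) = Square-rotation sq
    in proj₁ (Consec⇒∈ c-ya) , proj₁ (Consec⇒∈ y-bc) , rot-irrefl ¬c c-ya
  wing-apex ¬c (wing⁻ sq _ _) =
    let (_ , c-ay , y-cb , _) = Square-rotation sq
    in proj₂ (Consec⇒∈ c-ay) , proj₂ (Consec⇒∈ y-cb) , λ y≡a → rot-irrefl ¬c c-ay (sym y≡a)

  module _ {c d a b : Fin n} (c∈J₂ : part c ≡ P₂) (arm : Arm c d a b) where
    open Arm arm

    private
      ¬a : ¬ J₃ a
      ¬a = β⇒∉J₃ a-β
      ¬b : ¬ J₃ b
      ¬b = β⇒∉J₃ b-β
      ¬c : ¬ J₃ c
      ¬c = P₂⇒∉J₃ c∈J₂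
      a∈J₁ : part a ≡ P₁
      a∈J₁ = J₂-neighbour a∈c c∈J₂ ¬a
      b∈J₂ : part b ≡ P₂
      b∈J₂ = J₁-neighbour b∈a a∈J₁ ¬b

    wing : ∃ (Wing c a b)
    wing with ¬P-pair-adjacent (rot-unique a) (deg≤4 ¬a) (symm a c a∈c) b∈a c≢b ¬c ¬b
                (two-J₃-neighbours a-p a∈J₁) (proj₂ (proj₂ (proj₂ a-p)))
    ... | inj₁ (c-b , q , q-c , q∈J₃) =
      let (y , sq) = square-after ¬a c-b (λ b-ac → J₂-nonadjacent c∈J₂ b∈J₂ (proj₂ (Consec⇒∈ b-ac)))
      in y , wing⁺ sq q∈J₃ q-c
    ... | inj₂ (b-c , q , c-q , q∈J₃) =
      let (y , sq) = square-after ¬a b-c (λ c-ab → J₂-nonadjacent b∈J₂ c∈J₂ (proj₂ (Consec⇒∈ c-ab)))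
      in y , wing⁻ sq q∈J₃ c-q

    private
      only-exit : ∀ {e} → c ∈ rot d → b ∈ rot d → PBeta S d → e ∈ rot d → t e ≡ β → c ≢ e → e ≡ b
      only-exit c∈d b∈d d-p e∈d t-e c≢e
        with ¬P-pair-exhaustive (rot-unique d) (deg≤4 (proj₁ d-p)) c∈d b∈d c≢b ¬c ¬b
               (two-J₃-neighbours d-p (J₂-neighbour (symm c d c∈d) c∈J₂ (proj₁ d-p))) e∈d (β⇒∉J₃ t-e)
      ... | inj₁ e≡c = ⊥-elim (c≢e (sym e≡c))
      ... | inj₂ e≡b = e≡b

    wing-exit : ∀ {e} → BetaPath S t c d e → Wing c a b d → e ≡ b × OnFacialBetaCycle S t c d e
    wing-exit {e} (c∈d , d∈e , _ , _ , c≢e , t-c , t-d , t-e) (wing⁺ sq _ _) =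
      e≡b , subst (OnFacialBetaCycle S t c d) (sym e≡b)
                  (OnFacialBetaCycle-sym (β-square⇒OnFacialBetaCycle sq t-c a-β b-β t-d))
      where
      e≡b : e ≡ b
      e≡b = only-exit c∈d (proj₁ (Consec⇒∈ (proj₁ (proj₂ (proj₂ (Square-rotation sq))))))
                      (β-square⇒PBeta sq t-c a-β b-β t-d) (symm d _ d∈e) t-e c≢e
    wing-exit {e} (c∈d , d∈e , _ , _ , c≢e , t-c , t-d , t-e) (wing⁻ sq _ _) =
      e≡b , subst (OnFacialBetaCycle S t c d) (sym e≡b) (β-square⇒OnFacialBetaCycle sq b-β a-β t-c t-d)
      where
      e≡b : e ≡ b
      e≡b = only-exit c∈d (proj₂ (Consec⇒∈ (proj₁ (proj₂ (proj₂ (Square-rotation sq))))))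
                      (β-square⇒PBeta sq b-β a-β t-c t-d) (symm d _ d∈e) t-e c≢e

  -- Around c the order is y a d a′, so the faces q a c d and d c a′ q′ put c between q and q′
  -- around d.
  opposite-wings⇒X₃ : ∀ {c d e a a′ y q q′} → ¬ J₃ c → ¬ J₃ a → ¬ J₃ a′ → ¬ J₃ d →
    d ∈ rot c → e ∈ rot d → ¬ J₃ e → e ≢ c →
    a ≢ a′ → a ≢ d → a ≢ y → a′ ≢ d → a′ ≢ y → d ≢ y →
    Consec (rot c) y a → J₃ q → Consec (rot a) q c →
    Consec (rot c) a′ y → J₃ q′ → Consec (rot a′) c q′ → X₃ S d
  opposite-wings⇒X₃ {c} {d} {e} {a} {a′} {y} {q} {q′} ¬c ¬a ¬a′ ¬d d∈c e∈d ¬e e≢c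
                    a≢a′ a≢d a≢y a′≢d a′≢y d≢y c-ya q∈J₃ a-qc c-a′y q′∈J₃ a′-cq′ =
    flanked-¬P⇒Opposite (rot-unique _) (deg≤4 ¬d) d-cq d-q′c q∈J₃ q′∈J₃ ¬c e∈d ¬e e≢c
    where
    c-around : Consec (rot c) a d × Consec (rot c) d a′
    c-around = Consec-four-cycle (rot-unique _) (deg≤4 ¬c) d∈c a≢a′ a≢d a≢y a′≢d a′≢y d≢y c-ya c-a′y
    d-cq : Consec (rot d) c q
    d-cq = proj₁ (proj₂ (proj₂ (Square-rotation
             (square-of-path ¬a ¬c a-qc (proj₁ c-around) λ d≡q → ¬d (subst J₃ (sym d≡q) q∈J₃)))))
    d-q′c : Consec (rot d) q′ c
    d-q′c = proj₂ (proj₂ (proj₂ (Square-rotation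
              (square-of-path ¬c ¬a′ (proj₂ c-around) a′-cq′ λ q′≡d → ¬d (subst J₃ q′≡d q′∈J₃)))))

  wing⁺-turn : ∀ {c a b y} → Square c a b y → Consec (rot c) y a
  wing⁺-turn sq = proj₂ (proj₂ (proj₂ (Square-rotation sq)))

  wing⁻-turn : ∀ {c a b y} → Square b a c y → Consec (rot c) a y
  wing⁻-turn sq = proj₁ (proj₂ (Square-rotation sq))

  apex≢other-arm : ∀ {c d a b a′ b′ y} → part c ≡ P₂ → Arm c d a b → Arm c d a′ b′ → b ≢ b′ →
    Wing c a b y → y ≢ a′
  apex≢other-arm {c} {a′ = a′} c∈J₂ arm arm′ b≢b′ W y≡a′ =
    Sum.[ (λ b≡c → Arm.c≢b arm (sym b≡c)) , b≢b′ ]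
      (¬P-pair-exhaustive (rot-unique _) (deg≤4 ¬a′) (symm _ c (Arm.a∈c arm′)) (Arm.b∈a arm′)
        (Arm.c≢b arm′) ¬c (β⇒∉J₃ (Arm.b-β arm′))
        (two-J₃-neighbours (Arm.a-p arm′) (J₂-neighbour (Arm.a∈c arm′) c∈J₂ ¬a′))
        (subst (λ z → _ ∈ rot z) y≡a′ (proj₁ (proj₂ (wing-apex ¬c W)))) (β⇒∉J₃ (Arm.b-β arm)))
    where
    ¬c : ¬ J₃ c
    ¬c = P₂⇒∉J₃ c∈J₂
    ¬a′ : ¬ J₃ a′
    ¬a′ = β⇒∉J₃ (Arm.a-β arm′)

  apexes-miss-d-absurd : ∀ {c d e a b a′ b′ y y′} → part c ≡ P₂ → BetaPath S t c d e →
    Arm c d a b → Arm c d a′ b′ → a ≢ a′ → b ≢ b′ →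
    Wing c a b y → Wing c a′ b′ y′ → y ≢ d → y′ ≢ d → ⊥
  apexes-miss-d-absurd {c} {d} {e} {a} {b} {a′} {b′} {y} {y′}
                       c∈J₂ (c∈d , d∈e , _ , _ , c≢e , _ , t-d , t-e) arm arm′ a≢a′ b≢b′ W W′ y≢d y′≢d =
    orientations W (subst (Wing c a′ b′) (sym y≡y′) W′)
    where
    ¬c : ¬ J₃ c
    ¬c = P₂⇒∉J₃ c∈J₂
    y≢a : y ≢ a
    y≢a = proj₂ (proj₂ (wing-apex ¬c W))
    y≢a′ : y ≢ a′
    y≢a′ = apex≢other-arm c∈J₂ arm arm′ b≢b′ W
    y≡y′ : y ≡ y′
    y≡y′ = fourth-element-unique (rot-unique c) (deg≤4 ¬c) (Arm.a∈c arm) (Arm.a∈c arm′) (symm c d c∈d)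
             (proj₁ (wing-apex ¬c W)) (proj₁ (wing-apex ¬c W′)) a≢a′ (Arm.a≢d arm) (Arm.a≢d arm′)
             y≢a y≢a′ y≢d (apex≢other-arm c∈J₂ arm′ arm (≢-sym b≢b′) W′)
             (proj₂ (proj₂ (wing-apex ¬c W′))) y′≢d
    d-not-γ : ∀ {a a′ q q′} → ¬ J₃ a → ¬ J₃ a′ → a ≢ a′ → a ≢ d → a′ ≢ d → y ≢ a → y ≢ a′ →
      Consec (rot c) y a → J₃ q → Consec (rot a) q c →
      Consec (rot c) a′ y → J₃ q′ → Consec (rot a′) c q′ → ⊥
    d-not-γ ¬a ¬a′ a≢a′ a≢d a′≢d y≢a y≢a′ c-ya q∈J₃ a-qc c-a′y q′∈J₃ a′-cq′ =
      β⇒¬X₃ t-d (opposite-wings⇒X₃ ¬c ¬a ¬a′ (β⇒∉J₃ t-d) (symm c d c∈d)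
        (symm d e d∈e) (β⇒∉J₃ t-e) (≢-sym c≢e) a≢a′ a≢d (≢-sym y≢a) a′≢d (≢-sym y≢a′)
        (≢-sym y≢d) c-ya q∈J₃ a-qc c-a′y q′∈J₃ a′-cq′)
    ¬a : ¬ J₃ a
    ¬a = β⇒∉J₃ (Arm.a-β arm)
    ¬a′ : ¬ J₃ a′
    ¬a′ = β⇒∉J₃ (Arm.a-β arm′)
    orientations : Wing c a b y → Wing c a′ b′ y → ⊥
    orientations (wing⁺ sq _ _) (wing⁺ sq′ _ _) = a≢a′ (rot-functional ¬c (wing⁺-turn sq) (wing⁺-turn sq′))
    orientations (wing⁻ sq _ _) (wing⁻ sq′ _ _) = a≢a′ (rot-injective ¬c (wing⁻-turn sq) (wing⁻-turn sq′))
    orientations (wing⁺ sq q∈J₃ a-qc) (wing⁻ sq′ q′∈J₃ a′-cq′) =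
      d-not-γ ¬a ¬a′ a≢a′ (Arm.a≢d arm) (Arm.a≢d arm′) y≢a y≢a′
              (wing⁺-turn sq) q∈J₃ a-qc (wing⁻-turn sq′) q′∈J₃ a′-cq′
    orientations (wing⁻ sq q∈J₃ a-cq) (wing⁺ sq′ q′∈J₃ a′-q′c) =
      d-not-γ ¬a′ ¬a (≢-sym a≢a′) (Arm.a≢d arm′) (Arm.a≢d arm) y≢a′ y≢a
              (wing⁺-turn sq′) q′∈J₃ a′-q′c (wing⁻-turn sq) q∈J₃ a-cq

  through-arms : ∀ {c d e a b a′ b′} → part c ≡ P₂ → BetaPath S t c d e →
    Arm c d a b → Arm c d a′ b′ → a ≢ a′ → b ≢ b′ → (e ≡ b ⊎ e ≡ b′) × OnFacialBetaCycle S t c d e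
  through-arms {d = d} c∈J₂ path arm arm′ a≢a′ b≢b′
    with wing c∈J₂ arm | wing c∈J₂ arm′
  ... | y , W | y′ , W′ with y ≟ d | y′ ≟ d
  ... | yes refl | _ = map₁ inj₁ (wing-exit c∈J₂ arm path W)
  ... | no _ | yes refl = map₁ inj₂ (wing-exit c∈J₂ arm′ path W′)
  ... | no y≢d | no y′≢d = ⊥-elim (apexes-miss-d-absurd c∈J₂ path arm arm′ a≢a′ b≢b′ W W′ y≢d y′≢d)

  cycle-arms : ∀ {d} m (v : ℕ → Fin n) → ColCycle S t β (5 + m) v → ¬ OnCycle rot (5 + m) v d →
    Arm (v 0) d (v 1) (v 2) × Arm (v 0) d (v (4 + m)) (v (3 + m)) × v 1 ≢ v (4 + m) × v 2 ≢ v (3 + m)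
  cycle-arms {d} m v cycle@((_ , periodic , adjacent , injective) , coloured) d∉v =
    record { a∈c = symm _ _ (adjacent 0) ; b∈a = symm _ _ (adjacent 1)
           ; a-β = coloured 1 ; a-p = as1 _ v cycle 1 ; b-β = coloured 2
           ; c≢b = apart 0<k 2<k (λ ()) ; a≢d = off 1<k } ,
    record { a∈c = subst (λ z → v (4 + m) ∈ rot z) (periodic 0) (adjacent (4 + m)) ; b∈a = adjacent (3 + m)
           ; a-β = coloured (4 + m) ; a-p = as1 _ v cycle (4 + m) ; b-β = coloured (3 + m)
           ; c≢b = apart 0<k 3+m<k (λ ()) ; a≢d = off 4+m<k } ,
    apart 1<k 4+m<k (λ ()) , apart 2<k 3+m<k (λ ())
    where
    apart : ∀ {i j} → i < 5 + m → j < 5 + m → i ≢ j → v i ≢ v j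
    apart i<k j<k i≢j vi≡vj = i≢j (injective _ _ i<k j<k vi≡vj)
    off : ∀ {i} → i < 5 + m → v i ≢ d
    off i<k vi≡d = d∉v (_ , i<k , vi≡d)
    0<k : 0 < 5 + m
    0<k = s≤s z≤n
    1<k : 1 < 5 + m
    1<k = s≤s (s≤s z≤n)
    2<k : 2 < 5 + m
    2<k = s≤s (s≤s (s≤s z≤n))
    3+m<k : 3 + m < 5 + m
    3+m<k = s≤s (ℕ.n≤1+n (3 + m))
    4+m<k : 4 + m < 5 + m
    4+m<k = ℕ.n<1+n (4 + m)

  -- Length 5 already suffices: only c and the two vertices of C on each side of it must differ.
  through-cycle-vertex : ∀ {k c d e} (v : ℕ → Fin n) → ColCycle S t β k v → 5 ≤ k → v 0 ≡ c →
    BetaPath S t c d e → ¬ OnCycle rot k v d →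
    part c ≡ P₂ × OnCycle rot k v e × OnFacialBetaCycle S t c d e
  through-cycle-vertex {d = d} {e} v cycle (s≤s (s≤s (s≤s (s≤s (s≤s (z≤n {n = m})))))) refl
                       path@(c∈d , _ , _ , _ , _ , _ , t-d , _) d∉v
    with cycle-arms m v cycle d∉v
  ... | arm , arm′ , a≢a′ , b≢b′ =
    c∈J₂ ,
    Sum.[ (λ e≡b → 2 , s≤s (s≤s (s≤s z≤n)) , sym e≡b) ,
          (λ e≡b′ → 3 + m , s≤s (ℕ.n≤1+n (3 + m)) , sym e≡b′) ] (proj₁ exit) ,
    proj₂ exit
    where
    c∈J₂ : part (v 0) ≡ P₂
    c∈J₂ = three-neighbours⇒J₂ (as1 _ v cycle 0) (Arm.a∈c arm) (Arm.a∈c arm′) (symm _ _ c∈d)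
             a≢a′ (Arm.a≢d arm) (Arm.a≢d arm′)
             (β⇒∉J₃ (Arm.a-β arm)) (β⇒∉J₃ (Arm.a-β arm′)) (β⇒∉J₃ t-d)
    exit : (e ≡ v 2 ⊎ e ≡ v (3 + m)) × OnFacialBetaCycle S t (v 0) d e
    exit = through-arms c∈J₂ path arm arm′ a≢a′ b≢b′

lemma4p2 : ∀ {n : ℕ} (S : Setting n) (t : Fin n → Col) → Associated S t →
    ∀ (k : ℕ) (w : ℕ → Fin n) → ColCycle S t β k w → 6 ≤ k →
    ∀ (c d e : Fin n) → BetaPath S t c d e →
    OnCycle (Setting.rot S) k w c → ¬ OnCycle (Setting.rot S) k w d →
    Setting.part S c ≡ P₂ × OnCycle (Setting.rot S) k w e × OnFacialBetaCycle S t c d e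
lemma4p2 {n} S t As k w (cycle , coloured) 6≤k c d e path (i , i<k , wi≡c) d∉C =
  let (c∈J₂ , e∈C′ , facial) =
        through-cycle-vertex C′ (shift-IsCycle cycle i<k , λ x → coloured (i + x)) (ℕ.<⇒≤ 6≤k)
          (trans (shift-start i w) wi≡c) path (λ d∈C′ → d∉C (shift-OnCycle periodic i<k d∈C′))
  in c∈J₂ , shift-OnCycle periodic i<k e∈C′ , facial
  where
  open Configuration S t As
  open RotationCycles (Setting.rot S)
  periodic : Periodic (Setting.rot S) k w
  periodic = proj₁ (proj₂ cycle)
  C′ : ℕ → Fin n
  C′ = shift i w
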